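{- If $f\in\#\mathsf{FA}$, then for every constant $c\in\mathbb{N}$ the function $w\mapsto\min(f(w),c)$ is in $\#\mathsf{FA}$.
   Context: $\mathbb{N}=\{0,1,2,\dots\}$. An NFA is a tuple $M=(Q,\Sigma,\mathrm{wt},\mathrm{in},\mathrm{out})$ with $Q,\Sigma$ finite, $\mathrm{wt}:Q\times\Sigma\times Q\to\mathbb{N}$, $\mathrm{in},\mathrm{out}:Q\to\mathbb{N}$; on input $w=w_1\cdots w_n$ it outputs $\sum_{q_0,\dots,q_n\in Q}\mathrm{in}(q_0)\prod_{i=1}^n\mathrm{wt}(q_{i-1},w_i,q_i)\mathrm{out}(q_n)$. $\#\mathsf{FA}$ is the set of functions $\Sigma^\star\to\mathbb{N}$ (over finite alphabets $\Sigma$) computed by NFAs. -}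

module Defs where

open import Data.Nat using (ℕ; zero; suc; _+_; _*_)
open import Data.Fin using (Fin) renaming (zero to fzero; suc to fsuc)
open import Data.List using (List; []; _∷_)
open import Data.Product using (Σ; ∃)
open import Relation.Binary.PropositionalEquality using (_≡_)

sumFin : (k : ℕ) → (Fin k → ℕ) → ℕ
sumFin zero f = 0
sumFin (suc k) f = f fzero + sumFin k (λ i → f (fsuc i))

record NFA (s : ℕ) : Set where
  field
    k   : ℕ
    wt  : Fin k → Fin s → Fin k → ℕ
    inw : Fin k → ℕ
    out : Fin k → ℕ

open NFA public

-- pathSum M q w = Σ_{q_1..q_n} Π wt(q_{i-1},w_i,q_i) · out(q_n), with q_0 = q
-- (the literal sum over state sequences, written by nesting the sums)
pathSum : ∀ {s} (M : NFA s) → Fin (k M) → List (Fin s) → ℕ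
pathSum M q [] = out M q
pathSum M q (a ∷ w) = sumFin (k M) (λ q' → wt M q a q' * pathSum M q' w)

run : ∀ {s} → NFA s → List (Fin s) → ℕ
run M w = sumFin (k M) (λ q → inw M q * pathSum M q w)

InSharpFA : ∀ {s} → (List (Fin s) → ℕ) → Set
InSharpFA {s} f = Σ (NFA s) (λ M → ∀ w → run M w ≡ f w)

-- Capping at c, x ↦ x ⊓ c, is compatible with + and * : the capped value of a sum of
-- products only depends on the capped factors.  Hence the vector of path weights into each
-- state, capped at c, evolves deterministically while reading w and takes only finitely
-- many values, (c + 1)^|Q|.  A deterministic automaton on these capped vectors, whose
-- output is the capped inner product with out, computes w ↦ f w ⊓ c.
module Submission where

open import Defs
open import Data.Nat using (ℕ; _⊓_)
open import Data.Fin using (Fin)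
open import Data.List using (List)

open import Data.Nat using (zero; suc; _+_; _*_; _^_; _≤_; s≤s)
open import Data.Nat.Properties
open import Data.Fin using (toℕ; fromℕ<; funToFin; finToFun) renaming (zero to fzero; suc to fsuc)
open import Data.Fin.Properties using (toℕ-fromℕ<; finToFun-funToFin)
open import Data.List using ([]; _∷_; foldl)
open import Data.Product using (_,_)
open import Data.Sum using (inj₁; inj₂)
open import Relation.Binary.PropositionalEquality
open import Algebra.Properties.Semiring.Sum +-*-semiring using (sum; sum-cong-≗; ∑-comm)
open ≡-Reasoning

sumFin-cong : ∀ n {f g : Fin n → ℕ} → (∀ i → f i ≡ g i) → sumFin n f ≡ sumFin n g
sumFin-cong zero f≗g = refl
sumFin-cong (suc n) f≗g = cong₂ _+_ (f≗g fzero) (sumFin-cong n (λ i → f≗g (fsuc i)))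

sumFin≡sum : ∀ n (f : Fin n → ℕ) → sumFin n f ≡ sum f
sumFin≡sum zero f = refl
sumFin≡sum (suc n) f = cong (f fzero +_) (sumFin≡sum n (λ i → f (fsuc i)))

*-distribˡ-sumFin : ∀ n x (f : Fin n → ℕ) → x * sumFin n f ≡ sumFin n (λ i → x * f i)
*-distribˡ-sumFin zero x f = *-zeroʳ x
*-distribˡ-sumFin (suc n) x f =
  trans (*-distribˡ-+ x (f fzero) _) (cong (x * f fzero +_) (*-distribˡ-sumFin n x _))

*-distribʳ-sumFin : ∀ n x (f : Fin n → ℕ) → sumFin n f * x ≡ sumFin n (λ i → f i * x)
*-distribʳ-sumFin zero x f = refl
*-distribʳ-sumFin (suc n) x f =
  trans (*-distribʳ-+ x (f fzero) _) (cong (f fzero * x +_) (*-distribʳ-sumFin n x _))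

sumFin-comm : ∀ m n (f : Fin m → Fin n → ℕ) →
  sumFin m (λ i → sumFin n (f i)) ≡ sumFin n (λ j → sumFin m (λ i → f i j))
sumFin-comm m n f = begin
  sumFin m (λ i → sumFin n (f i))        ≡⟨ sumFin²≡sum² m n f ⟩
  sum (λ i → sum (f i))                  ≡⟨ ∑-comm f ⟩
  sum (λ j → sum (λ i → f i j))          ≡⟨ sumFin²≡sum² n m (λ j i → f i j) ⟨
  sumFin n (λ j → sumFin m (λ i → f i j)) ∎
  where
  sumFin²≡sum² : ∀ m n (g : Fin m → Fin n → ℕ) →
    sumFin m (λ i → sumFin n (g i)) ≡ sum (λ i → sum (g i))
  sumFin²≡sum² m n g =
    trans (sumFin≡sum m _) (sum-cong-≗ (λ i → sumFin≡sum n (g i)))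

δ : ∀ {n} → Fin n → Fin n → ℕ
δ fzero    fzero    = 1
δ fzero    (fsuc _) = 0
δ (fsuc _) fzero    = 0
δ (fsuc i) (fsuc j) = δ i j

sumFin-δ : ∀ n (i : Fin n) (f : Fin n → ℕ) → sumFin n (λ j → δ i j * f j) ≡ f i
sumFin-δ (suc n) fzero f = begin
  f fzero + 0 + sumFin n (λ j → 0) ≡⟨ cong (f fzero + 0 +_) (sumFin-zero n) ⟩
  f fzero + 0 + 0                   ≡⟨ cong (_+ 0) (+-identityʳ (f fzero)) ⟩
  f fzero + 0                       ≡⟨ +-identityʳ (f fzero) ⟩
  f fzero                           ∎
  where
  sumFin-zero : ∀ n → sumFin n (λ _ → 0) ≡ 0
  sumFin-zero zero = refl
  sumFin-zero (suc n) = sumFin-zero n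
sumFin-δ (suc n) (fsuc i) f = sumFin-δ n i (λ j → f (fsuc j))

module _ (c : ℕ) where

  ⊓-capped : ∀ {a b} → c ≤ a → c ≤ b → a ⊓ c ≡ b ⊓ c
  ⊓-capped c≤a c≤b = trans (m≥n⇒m⊓n≡n c≤a) (sym (m≥n⇒m⊓n≡n c≤b))

  +-⊓-cap : ∀ a b → (a + b) ⊓ c ≡ (a ⊓ c + b ⊓ c) ⊓ c
  +-⊓-cap a b with ≤-total a c | ≤-total b c
  ... | inj₁ a≤c | inj₁ b≤c rewrite m≤n⇒m⊓n≡m a≤c | m≤n⇒m⊓n≡m b≤c = refl
  ... | inj₂ c≤a | _ =
    ⊓-capped (≤-trans c≤a (m≤m+n a b)) (≤-trans (⊓-glb c≤a ≤-refl) (m≤m+n _ _))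
  ... | inj₁ _ | inj₂ c≤b =
    ⊓-capped (≤-trans c≤b (m≤n+m b a)) (≤-trans (⊓-glb c≤b ≤-refl) (m≤n+m _ _))

  *-⊓-capˡ : ∀ a b → (a * b) ⊓ c ≡ ((a ⊓ c) * b) ⊓ c
  *-⊓-capˡ a zero rewrite *-zeroʳ a | *-zeroʳ (a ⊓ c) = refl
  *-⊓-capˡ a (suc b) with ≤-total a c
  ... | inj₁ a≤c rewrite m≤n⇒m⊓n≡m a≤c = refl
  ... | inj₂ c≤a =
    ⊓-capped (≤-trans c≤a (m≤m*n a (suc b))) (≤-trans (⊓-glb c≤a ≤-refl) (m≤m*n _ (suc b)))

  sumFin-*-⊓-capˡ : ∀ n (x y : Fin n → ℕ) →
    sumFin n (λ i → x i * y i) ⊓ c ≡ sumFin n (λ i → (x i ⊓ c) * y i) ⊓ c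
  sumFin-*-⊓-capˡ zero x y = refl
  sumFin-*-⊓-capˡ (suc n) x y = begin
    (x₀ * y₀ + Σxy) ⊓ c                           ≡⟨ +-⊓-cap (x₀ * y₀) Σxy ⟩
    ((x₀ * y₀) ⊓ c + Σxy ⊓ c) ⊓ c                 ≡⟨ cong₂ (λ u v → (u + v) ⊓ c)
                                                       (*-⊓-capˡ x₀ y₀)
                                                       (sumFin-*-⊓-capˡ n (λ i → x (fsuc i)) (λ i → y (fsuc i))) ⟩
    (((x₀ ⊓ c) * y₀) ⊓ c + Σx⊓cy ⊓ c) ⊓ c         ≡⟨ +-⊓-cap ((x₀ ⊓ c) * y₀) Σx⊓cy ⟨
    ((x₀ ⊓ c) * y₀ + Σx⊓cy) ⊓ c                   ∎
    where
    x₀ = x fzero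
    y₀ = y fzero
    Σxy = sumFin n (λ i → x (fsuc i) * y (fsuc i))
    Σx⊓cy = sumFin n (λ i → (x (fsuc i) ⊓ c) * y (fsuc i))

module _ {s n : ℕ} (next : Fin n → Fin s → Fin n) (output : Fin n → ℕ) where

  deterministic : Fin n → NFA s
  deterministic start = record
    { k = n ; wt = λ x a → δ (next x a) ; inw = δ start ; out = output }

  pathSum-deterministic : ∀ start x w →
    pathSum (deterministic start) x w ≡ output (foldl next x w)
  pathSum-deterministic start x [] = refl
  pathSum-deterministic start x (a ∷ w) =
    trans (sumFin-δ n (next x a) _) (pathSum-deterministic start (next x a) w)

  run-deterministic : ∀ start w → run (deterministic start) w ≡ output (foldl next start w)
  run-deterministic start w =
    trans (sumFin-δ n start _) (pathSum-deterministic start start w)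

module _ {s : ℕ} (M : NFA s) where

  weighted : (Fin (k M) → ℕ) → List (Fin s) → ℕ
  weighted u w = sumFin (k M) (λ q → u q * pathSum M q w)

  transition : (Fin (k M) → ℕ) → Fin s → Fin (k M) → ℕ
  transition u a q′ = sumFin (k M) (λ q → u q * wt M q a q′)

  weighted-cong : ∀ {u v} → (∀ q → u q ≡ v q) → ∀ w → weighted u w ≡ weighted v w
  weighted-cong u≗v w = sumFin-cong (k M) (λ q → cong (_* pathSum M q w) (u≗v q))

  weighted-∷ : ∀ u a w → weighted u (a ∷ w) ≡ weighted (transition u a) w
  weighted-∷ u a w = begin
    sumFin K (λ q → u q * sumFin K (λ q′ → wt M q a q′ * pathSum M q′ w))
      ≡⟨ sumFin-cong K (λ q → *-distribˡ-sumFin K (u q) _) ⟩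
    sumFin K (λ q → sumFin K (λ q′ → u q * (wt M q a q′ * pathSum M q′ w)))
      ≡⟨ sumFin-comm K K _ ⟩
    sumFin K (λ q′ → sumFin K (λ q → u q * (wt M q a q′ * pathSum M q′ w)))
      ≡⟨ sumFin-cong K (λ q′ → sumFin-cong K (λ q → *-assoc (u q) _ _)) ⟨
    sumFin K (λ q′ → sumFin K (λ q → u q * wt M q a q′ * pathSum M q′ w))
      ≡⟨ sumFin-cong K (λ q′ → *-distribʳ-sumFin K (pathSum M q′ w) _) ⟨
    sumFin K (λ q′ → transition u a q′ * pathSum M q′ w) ∎
    where K = k M

module Capped (c : ℕ) {s : ℕ} (M : NFA s) where

  -- Capped weight vectors {0,…,c}^Q, stored as Fin ((c + 1)^|Q|) so that they can serve as states.
  State : Set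
  State = Fin (suc c ^ k M)

  value : State → Fin (k M) → ℕ
  value x q = toℕ (finToFun x q)

  capture : (Fin (k M) → ℕ) → State
  capture u = funToFin (λ q → fromℕ< (s≤s (m⊓n≤n (u q) c)))

  value-capture : ∀ u q → value (capture u) q ≡ u q ⊓ c
  value-capture u q = trans (cong toℕ (finToFun-funToFin _ q)) (toℕ-fromℕ< _)

  weighted-capture : ∀ u w → weighted M (value (capture u)) w ⊓ c ≡ weighted M u w ⊓ c
  weighted-capture u w = begin
    weighted M (value (capture u)) w ⊓ c    ≡⟨ cong (_⊓ c) (weighted-cong M (value-capture u) w) ⟩
    weighted M (λ q → u q ⊓ c) w ⊓ c        ≡⟨ sumFin-*-⊓-capˡ c (k M) u _ ⟨
    weighted M u w ⊓ c                      ∎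

  next : State → Fin s → State
  next x a = capture (transition M (value x) a)

  output : State → ℕ
  output x = weighted M (value x) [] ⊓ c

  output-foldl : ∀ x w → output (foldl next x w) ≡ weighted M (value x) w ⊓ c
  output-foldl x [] = refl
  output-foldl x (a ∷ w) = begin
    output (foldl next (next x a) w)              ≡⟨ output-foldl (next x a) w ⟩
    weighted M (value (next x a)) w ⊓ c           ≡⟨ weighted-capture (transition M (value x) a) w ⟩
    weighted M (transition M (value x) a) w ⊓ c   ≡⟨ cong (_⊓ c) (weighted-∷ M (value x) a w) ⟨
    weighted M (value x) (a ∷ w) ⊓ c              ∎

  automaton : NFA s
  automaton = deterministic next output (capture (inw M))

  run-automaton : ∀ w → run automaton w ≡ run M w ⊓ c
  run-automaton w = begin
    run automaton w                             ≡⟨ run-deterministic next output (capture (inw M)) w ⟩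
    output (foldl next (capture (inw M)) w)     ≡⟨ output-foldl (capture (inw M)) w ⟩
    weighted M (value (capture (inw M))) w ⊓ c  ≡⟨ weighted-capture (inw M) w ⟩
    run M w ⊓ c                                 ∎

lemma7 : (s : ℕ) (f : List (Fin s) → ℕ) → InSharpFA f →
    (c : ℕ) → InSharpFA (λ w → f w ⊓ c)
lemma7 s f (M , M≗f) c =
  Capped.automaton c M , λ w → trans (Capped.run-automaton c M w) (cong (_⊓ c) (M≗f w))
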